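{- For each $n\geq 1$, the reliability polynomial of the Schreier graph $\Gamma_n$ of the Grigorchuk group is $$R(\Gamma_n,p)=p^{2^n-1}(2-p)^{2^{n-1}-1}.$$
   Context: Let $X^n$ denote the set of binary words of length $n$ over $\{0,1\}$. The Grigorchuk group is generated by the automorphisms $a,b,c,d$ of the rooted binary tree defined recursively on finite binary words $w$ by $a(0w)=1w$, $a(1w)=0w$, $b(0w)=0a(w)$, $b(1w)=1c(w)$, $c(0w)=0a(w)$, $c(1w)=1d(w)$, $d(0w)=0w$, $d(1w)=1b(w)$; each generator is an involution. For $n\geq1$, the Schreier graph $\Gamma_n$ is the finite multigraph with vertex set $X^n$ having, for each $s\in\{a,b,c,d\}$ and each orbit $\{u,s(u)\}$ of $s$ on $X^n$, one edge joining $u$ and $s(u)$ (a loop when $s(u)=u$). (As an unlabelled multigraph, $\Gamma_n$ has vertices $v_1,\dots,v_{2^n}$ on a line, a single edge between $v_{2k-1},v_{2k}$ for $1\le k\le 2^{n-1}$, two parallel edges between $v_{2k},v_{2k+1}$ for $1\le k\le 2^{n-1}-1$, one loop at each of $v_2,\dots,v_{2^n-1}$ and three loops at each of $v_1,v_{2^n}$.) For a connected finite multigraph $G$ and $p\in[0,1]$, the reliability polynomial $R(G,p)$ is the probability that, when each edge is independently declared active with probability $p$ and inactive with probability $1-p$, every pair of vertices is joined by a path of active edges.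
   Formalization: The probability $p$ ranges over the rationals in $[0,1]$. -}

module Defs where

open import Data.Bool using (Bool; true; false; if_then_else_)
open import Data.Nat using (ℕ; zero; suc; _∸_)
open import Data.Vec using (Vec; []; _∷_)
open import Data.List using (List; []; _∷_; map; _++_; concatMap; filter; length; foldr)
open import Data.Product using (Σ; _×_; _,_)
open import Data.Sum using (_⊎_)
open import Relation.Binary.PropositionalEquality using (_≡_)
open import Relation.Binary.Construct.Closure.ReflexiveTransitive using (Star)
open import Relation.Nullary using (Dec; does)
open import Relation.Nullary.Decidable using (T?)
open import Data.List.Membership.Propositional using (_∈_)
open import Data.Rational using (ℚ; 0ℚ; 1ℚ; _+_; _*_; _-_)

-- Binary words of length n; the letter 0 is false, the letter 1 is true.
Word : ℕ → Set
Word n = Vec Bool n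

data Gen : Set where
  a b c d : Gen

act : Gen → ∀ {n} → Word n → Word n
act _ [] = []
act a (false ∷ w) = true ∷ w
act a (true ∷ w) = false ∷ w
act b (false ∷ w) = false ∷ act a w
act b (true ∷ w) = true ∷ act c w
act c (false ∷ w) = false ∷ act a w
act c (true ∷ w) = true ∷ act d w
act d (false ∷ w) = false ∷ w
act d (true ∷ w) = true ∷ act b w

allWords : (n : ℕ) → List (Word n)
allWords zero = [] ∷ []
allWords (suc n) = map (false ∷_) (allWords n) ++ map (true ∷_) (allWords n)

-- Lexicographic order (false < true), used to pick one representative
-- of each orbit {u, s(u)}.
lexLeq : ∀ {n} → Word n → Word n → Bool
lexLeq [] [] = true
lexLeq (false ∷ u) (false ∷ v) = lexLeq u v
lexLeq (true ∷ u) (true ∷ v) = lexLeq u v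
lexLeq (false ∷ u) (true ∷ v) = true
lexLeq (true ∷ u) (false ∷ v) = false

-- An edge of Γ_n labelled by s, represented by the lexicographically
-- smaller endpoint u of the orbit {u, s(u)}; it joins u and s(u)
-- (a loop when s(u) = u).
Edge : ℕ → Set
Edge n = Gen × Word n

gens : List Gen
gens = a ∷ b ∷ c ∷ d ∷ []

-- The edge multiset of Γ_n: one edge per generator s and orbit of s on X^n.
edges : (n : ℕ) → List (Edge n)
edges n = concatMap (λ s → map (λ u → (s , u))
            (filter (λ u → T? (lexLeq u (act s u))) (allWords n))) gens

Joins : ∀ {n} → Edge n → Word n → Word n → Set
Joins (s , u) x y = (x ≡ u × y ≡ act s u) ⊎ (y ≡ u × x ≡ act s u)

Adj : ∀ {n} → List (Edge n) → Word n → Word n → Set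
Adj S x y = Σ _ (λ e → e ∈ S × Joins e x y)

Connected : ∀ {n} → List (Edge n) → Set
Connected {n} S = (x y : Word n) → Star (Adj S) x y

subsets : ∀ {A : Set} → List A → List (List A)
subsets [] = [] ∷ []
subsets (x ∷ xs) = map (x ∷_) (subsets xs) ++ subsets xs

_^ℚ_ : ℚ → ℕ → ℚ
q ^ℚ zero = 1ℚ
q ^ℚ suc k = q * (q ^ℚ k)

-- Connectivity is decided by any given decision procedure `dec`
-- (all decision procedures for a proposition agree).
reliability : (n : ℕ) → ((S : List (Edge n)) → Dec (Connected S)) → ℚ → ℚ
reliability n dec p =
  foldr _+_ 0ℚ (map (λ S → if does (dec S)
                   then (p ^ℚ length S) * ((1ℚ - p) ^ℚ (length (edges n) ∸ length S))
                   else 0ℚ)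
           (subsets (edges n)))

module Submission where

-- Reading words as Gray codes puts the vertices of Γₙ on a line 0, 1, …, 2ⁿ − 1: every
-- a-edge joins 2k and 2k + 1, every b-, c- or d-edge is a loop or joins 2k + 1 and 2k + 2,
-- and the segment {i, i + 1} carries one edge for even i and two for odd i. A set of edges
-- connects such a thickened path exactly when it meets every segment, so the segments fail
-- independently and R(Γₙ, p) = ∏ᵢ (1 − (1 − p)^{mᵢ}) with mᵢ alternating 1, 2, 1, …, 1.
-- The product formula holds for any list of edges indexed by segments and is proved by
-- deleting or keeping one edge at a time, remembering which segments are already met.

open import Defs
open import Data.Bool using (Bool; true; false; _∧_; _∨_; if_then_else_)
open import Data.Empty using (⊥-elim)
open import Data.List using (List; []; _∷_; map; length)
open import Data.List.Relation.Unary.All as All using (All; []; _∷_)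
open import Data.List.Relation.Unary.All.Properties using (++⁺; map⁺)
open import Data.Nat using (ℕ; zero; suc; _<_; _∸_; _^_; z≤n; s≤s) renaming (_≤_ to _≤ℕ_)
open import Data.Nat.Properties using (m≤n⇒m≤1+n)
open import Data.Product using (Σ; _×_; _,_)
open import Relation.Binary.PropositionalEquality
open import Relation.Nullary using (Dec; does; yes; no)
open import Relation.Nullary.Decidable using (dec-true; dec-false)

witness : ∀ {A : Set} (a? : Dec A) → does a? ≡ true → A
witness (yes x) _ = x

subsets-length : ∀ {A : Set} (L : List A) → All (λ S → length S ≤ℕ length L) (subsets L)
subsets-length []      = z≤n ∷ []
subsets-length (e ∷ L) = ++⁺ (map⁺ (All.map s≤s (subsets-length L))) (All.map m≤n⇒m≤1+n (subsets-length L))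

module Counting where

  open import Data.Nat using (_+_; _≟_; s≤s⁻¹)
  open import Data.Nat.Properties using (≤-refl; m<n⇒m<1+n; ≤∧≢⇒<)
  open import Data.Bool.Properties using (∧-conicalˡ; ∧-conicalʳ)
  open import Data.List using (_++_; filter; concatMap)
  open import Data.Nat.ListAction using (sum)
  open import Relation.Nullary.Decidable using (T?)

  countᵇ : ∀ {A : Set} → (A → Bool) → List A → ℕ
  countᵇ g []       = 0
  countᵇ g (x ∷ xs) = if g x then suc (countᵇ g xs) else countᵇ g xs

  module _ {A : Set} where

    countᵇ-++ : ∀ (g : A → Bool) xs ys → countᵇ g (xs ++ ys) ≡ countᵇ g xs + countᵇ g ys
    countᵇ-++ g []       ys = refl
    countᵇ-++ g (x ∷ xs) ys with g x
    ... | true  = cong suc (countᵇ-++ g xs ys)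
    ... | false = countᵇ-++ g xs ys

    countᵇ-map : ∀ {B : Set} (g : B → Bool) (f : A → B) xs →
      countᵇ g (map f xs) ≡ countᵇ (λ x → g (f x)) xs
    countᵇ-map g f []       = refl
    countᵇ-map g f (x ∷ xs) with g (f x)
    ... | true  = cong suc (countᵇ-map g f xs)
    ... | false = countᵇ-map g f xs

    countᵇ-filter : ∀ (g h : A → Bool) xs →
      countᵇ g (filter (λ x → T? (h x)) xs) ≡ countᵇ (λ x → h x ∧ g x) xs
    countᵇ-filter g h []       = refl
    countᵇ-filter g h (x ∷ xs) with h x
    ... | false = countᵇ-filter g h xs
    ... | true with g x
    ...   | true  = cong suc (countᵇ-filter g h xs)
    ...   | false = countᵇ-filter g h xs

    countᵇ-none : ∀ (g : A → Bool) xs → (∀ x → g x ≡ false) → countᵇ g xs ≡ 0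
    countᵇ-none g []       _    = refl
    countᵇ-none g (x ∷ xs) none rewrite none x = countᵇ-none g xs none

  countᵇ-concatMap : ∀ {A B : Set} (g : B → Bool) (f : A → List B) xs →
    countᵇ g (concatMap f xs) ≡ sum (map (λ x → countᵇ g (f x)) xs)
  countᵇ-concatMap g f []       = refl
  countᵇ-concatMap g f (x ∷ xs) =
    trans (countᵇ-++ g (f x) (concatMap f xs)) (cong (countᵇ g (f x) +_) (countᵇ-concatMap g f xs))

  allBelow : ℕ → (ℕ → Bool) → Bool
  allBelow zero    f = true
  allBelow (suc N) f = f N ∧ allBelow N f

  allBelow-cong : ∀ N {f g : ℕ → Bool} → (∀ i → f i ≡ g i) → allBelow N f ≡ allBelow N g
  allBelow-cong zero    _  = refl
  allBelow-cong (suc N) eq = cong₂ _∧_ (eq N) (allBelow-cong N eq)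

  allBelow-intro : ∀ N {f} → (∀ i → i < N → f i ≡ true) → allBelow N f ≡ true
  allBelow-intro zero    _   = refl
  allBelow-intro (suc N) all = cong₂ _∧_ (all N ≤-refl) (allBelow-intro N (λ i i<N → all i (m<n⇒m<1+n i<N)))

  allBelow-elim : ∀ N {f} → allBelow N f ≡ true → ∀ i → i < N → f i ≡ true
  allBelow-elim (suc N) {f} all i i<1+N with i ≟ N
  ... | yes refl = ∧-conicalˡ (f N) _ all
  ... | no i≢N   = allBelow-elim N (∧-conicalʳ (f N) _ all) i (≤∧≢⇒< (s≤s⁻¹ i<1+N) i≢N)

module RationalSums where

  open import Data.Nat using (_≟_)
  open import Data.Nat.Properties using (≤-refl; m<n⇒m<1+n; <⇒≢)
  open import Data.List using (_++_; foldr)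
  open import Data.Maybe using (Maybe; just; nothing)
  open import Data.Rational using (ℚ; 0ℚ; 1ℚ; _+_; _*_; _-_)
  open import Data.Rational.Properties
    using (+-*-commutativeRing; +-identityˡ; +-assoc; *-zeroʳ; *-distribˡ-+)
    renaming (_≟_ to _≟ℚ_)
  open import Tactic.RingSolver using (solve-∀)
  open import Tactic.RingSolver.Core.AlmostCommutativeRing using (AlmostCommutativeRing; fromCommutativeRing)

  ℚ-ring : AlmostCommutativeRing _ _
  ℚ-ring = fromCommutativeRing +-*-commutativeRing isZero
    where
    isZero : ∀ x → Maybe (0ℚ ≡ x)
    isZero x with 0ℚ ≟ℚ x
    ... | yes 0≡x = just 0≡x
    ... | no _    = nothing

  sumℚ : List ℚ → ℚ
  sumℚ = foldr _+_ 0ℚ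

  sumℚ-++ : ∀ xs ys → sumℚ (xs ++ ys) ≡ sumℚ xs + sumℚ ys
  sumℚ-++ []       ys = sym (+-identityˡ _)
  sumℚ-++ (x ∷ xs) ys = trans (cong (x +_) (sumℚ-++ xs ys)) (sym (+-assoc x _ _))

  sumℚ-scale : ∀ {A : Set} r (f : A → ℚ) xs → sumℚ (map (λ x → r * f x) xs) ≡ r * sumℚ (map f xs)
  sumℚ-scale r f []       = sym (*-zeroʳ r)
  sumℚ-scale r f (x ∷ xs) = trans (cong (r * f x +_) (sumℚ-scale r f xs)) (sym (*-distribˡ-+ r (f x) _))

  ∏< : ℕ → (ℕ → ℚ) → ℚ
  ∏< zero    f = 1ℚ
  ∏< (suc N) f = f N * ∏< N f

  ∏<-cong : ∀ N {f g : ℕ → ℚ} → (∀ i → i < N → f i ≡ g i) → ∏< N f ≡ ∏< N g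
  ∏<-cong zero    _  = refl
  ∏<-cong (suc N) eq = cong₂ _*_ (eq N ≤-refl) (∏<-cong N (λ i i<N → eq i (m<n⇒m<1+n i<N)))

  ∏<-affine : ∀ p N k {f g r : ℕ → ℚ} → (∀ i → i ≢ k → f i ≡ r i) → (∀ i → i ≢ k → g i ≡ r i) →
    p * f k + (1ℚ - p) * g k ≡ r k → p * ∏< N f + (1ℚ - p) * ∏< N g ≡ ∏< N r
  ∏<-affine p zero k _ _ _ = affine-1 p
    where
    affine-1 : ∀ p → p * 1ℚ + (1ℚ - p) * 1ℚ ≡ 1ℚ
    affine-1 = solve-∀ ℚ-ring
  ∏<-affine p (suc N) k {f} {g} {r} f≈r g≈r at-k with N ≟ k
  ... | yes refl = begin
    p * (f N * ∏< N f) + (1ℚ - p) * (g N * ∏< N g)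
      ≡⟨ cong₂ (λ x y → p * (f N * x) + (1ℚ - p) * (g N * y))
               (∏<-cong N (λ i i<N → f≈r i (<⇒≢ i<N))) (∏<-cong N (λ i i<N → g≈r i (<⇒≢ i<N))) ⟩
    p * (f N * ∏< N r) + (1ℚ - p) * (g N * ∏< N r)
      ≡⟨ distribʳ p (f N) (g N) (∏< N r) ⟩
    (p * f N + (1ℚ - p) * g N) * ∏< N r
      ≡⟨ cong (_* ∏< N r) at-k ⟩
    r N * ∏< N r ∎
    where
    open ≡-Reasoning
    distribʳ : ∀ p x y z → p * (x * z) + (1ℚ - p) * (y * z) ≡ (p * x + (1ℚ - p) * y) * z
    distribʳ = solve-∀ ℚ-ring
  ... | no N≢k = begin
    p * (f N * ∏< N f) + (1ℚ - p) * (g N * ∏< N g)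
      ≡⟨ cong₂ (λ x y → p * (x * ∏< N f) + (1ℚ - p) * (y * ∏< N g)) (f≈r N N≢k) (g≈r N N≢k) ⟩
    p * (r N * ∏< N f) + (1ℚ - p) * (r N * ∏< N g)
      ≡⟨ distribˡ p (r N) (∏< N f) (∏< N g) ⟩
    r N * (p * ∏< N f + (1ℚ - p) * ∏< N g)
      ≡⟨ cong (r N *_) (∏<-affine p N k f≈r g≈r at-k) ⟩
    r N * ∏< N r ∎
    where
    open ≡-Reasoning
    distribˡ : ∀ p x y z → p * (x * y) + (1ℚ - p) * (x * z) ≡ x * (p * y + (1ℚ - p) * z)
    distribˡ = solve-∀ ℚ-ring

  if-scale : ∀ t r x → (if t then r * x else 0ℚ) ≡ r * (if t then x else 0ℚ)
  if-scale true  r x = refl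
  if-scale false r x = sym (*-zeroʳ r)

-- A multigraph on the path 0 — 1 — ⋯ — N whose edge e lies on the segment {index e, index e + 1}
-- (edges with index ≥ N are loops). Marked segments count as already met: carrying them along
-- is what lets the product formula be proved one edge at a time.
module SegmentReliability {E : Set} (index : E → ℕ) (N : ℕ) where

  open Counting
  open RationalSums
  open import Data.Nat using (_≤_; _≟_)
  open import Data.Nat.Properties using (+-∸-assoc)
  open import Data.Bool.Properties using (∨-assoc; ∨-zeroʳ; ∨-identityʳ)
  open import Data.List using (_++_)
  open import Data.List.Properties using (map-++; map-∘; map-cong; map-cong-local)
  open import Data.List.Relation.Unary.Any using (here; there)
  open import Data.List.Membership.Propositional using (_∈_)
  open import Data.Rational using (ℚ; 0ℚ; 1ℚ; _+_; _*_; _-_)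
  open import Data.Rational.Properties using (*-assoc; *-zeroˡ; *-identityˡ)
  open import Tactic.RingSolver using (solve-∀)

  hits : ℕ → List E → Bool
  hits i []      = false
  hits i (e ∷ S) = does (index e ≟ i) ∨ hits i S

  hits-intro : ∀ {S e i} → e ∈ S → index e ≡ i → hits i S ≡ true
  hits-intro {e ∷ S} (here refl) idx rewrite dec-true (index e ≟ _) idx = refl
  hits-intro {e ∷ S} (there e′∈S) idx rewrite hits-intro e′∈S idx = ∨-zeroʳ _

  hits-elim : ∀ S {i} → hits i S ≡ true → Σ E λ e → e ∈ S × index e ≡ i
  hits-elim (e ∷ S) {i} hit with does (index e ≟ i) in idx
  ... | true  = e , here refl , witness (index e ≟ i) idx
  ... | false = let e′ , e′∈S , idx = hits-elim S hit in e′ , there e′∈S , idx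

  mark : ℕ → (ℕ → Bool) → ℕ → Bool
  mark k marked i = marked i ∨ does (k ≟ i)

  covers : (ℕ → Bool) → List E → Bool
  covers marked S = allBelow N (λ i → marked i ∨ hits i S)

  covers-∷ : ∀ marked e S → covers marked (e ∷ S) ≡ covers (mark (index e) marked) S
  covers-∷ marked e S = allBelow-cong N (λ i → sym (∨-assoc (marked i) _ (hits i S)))

  multiplicity : ℕ → List E → ℕ
  multiplicity i = countᵇ (λ e → does (index e ≟ i))

  module _ (p : ℚ) where

    q : ℚ
    q = 1ℚ - p

    weight : List E → List E → ℚ
    weight L S = (p ^ℚ length S) * (q ^ℚ (length L ∸ length S))

    term : (ℕ → Bool) → List E → List E → ℚ
    term marked L S = if covers marked S then weight L S else 0ℚ

    reliabilitySum : (ℕ → Bool) → List E → ℚ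
    reliabilitySum marked L = sumℚ (map (term marked L) (subsets L))

    factor : Bool → ℕ → ℚ
    factor true  _ = 1ℚ
    factor false m = 1ℚ - q ^ℚ m

    term-∷-chosen : ∀ marked e L S → term marked (e ∷ L) (e ∷ S) ≡ p * term (mark (index e) marked) L S
    term-∷-chosen marked e L S =
      trans (cong₂ (λ t x → if t then x else 0ℚ) (covers-∷ marked e S)
                   (*-assoc p (p ^ℚ length S) (q ^ℚ (length L ∸ length S))))
            (if-scale _ p _)

    term-∷-skipped : ∀ marked e L {S} → length S ≤ length L → term marked (e ∷ L) S ≡ q * term marked L S
    term-∷-skipped marked e L {S} S≤L =
      trans (cong (λ x → if covers marked S then x else 0ℚ) weight-skipped) (if-scale _ q _)
      where
      swap : ∀ x y z → x * (y * z) ≡ y * (x * z)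
      swap = solve-∀ ℚ-ring
      weight-skipped : weight (e ∷ L) S ≡ q * weight L S
      weight-skipped = trans (cong (λ m → (p ^ℚ length S) * (q ^ℚ m)) (+-∸-assoc 1 S≤L))
                             (swap (p ^ℚ length S) q (q ^ℚ (length L ∸ length S)))

    reliabilitySum-∷ : ∀ marked e L →
      reliabilitySum marked (e ∷ L) ≡ p * reliabilitySum (mark (index e) marked) L + q * reliabilitySum marked L
    reliabilitySum-∷ marked e L = begin
      sumℚ (map (term marked (e ∷ L)) (map (e ∷_) (subsets L) ++ subsets L))
        ≡⟨ cong sumℚ (map-++ (term marked (e ∷ L)) (map (e ∷_) (subsets L)) (subsets L)) ⟩
      sumℚ (map (term marked (e ∷ L)) (map (e ∷_) (subsets L)) ++ map (term marked (e ∷ L)) (subsets L))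
        ≡⟨ sumℚ-++ (map (term marked (e ∷ L)) (map (e ∷_) (subsets L)))
                   (map (term marked (e ∷ L)) (subsets L)) ⟩
      sumℚ (map (term marked (e ∷ L)) (map (e ∷_) (subsets L))) + sumℚ (map (term marked (e ∷ L)) (subsets L))
        ≡⟨ cong₂ (λ xs ys → sumℚ xs + sumℚ ys)
                 (trans (sym (map-∘ (subsets L))) (map-cong (term-∷-chosen marked e L) (subsets L)))
                 (map-cong-local (All.map (λ {S} → term-∷-skipped marked e L {S}) (subsets-length L))) ⟩
      sumℚ (map (λ S → p * term (mark (index e) marked) L S) (subsets L))
        + sumℚ (map (λ S → q * term marked L S) (subsets L))
        ≡⟨ cong₂ _+_ (sumℚ-scale p _ (subsets L)) (sumℚ-scale q _ (subsets L)) ⟩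
      p * reliabilitySum (mark (index e) marked) L + q * reliabilitySum marked L ∎
      where open ≡-Reasoning

    reliabilitySum-[] : ∀ marked → reliabilitySum marked [] ≡ ∏< N (λ i → factor (marked i) 0)
    reliabilitySum-[] marked = trans (only-term (covers marked [])) (sym (∏<-factor-0 N))
      where
      only-term : ∀ t → (if t then weight [] [] else 0ℚ) + 0ℚ ≡ (if t then 1ℚ else 0ℚ)
      only-term true  = refl
      only-term false = refl
      ∏<-factor-0 : ∀ M →
        ∏< M (λ i → factor (marked i) 0) ≡ (if allBelow M (λ i → marked i ∨ false) then 1ℚ else 0ℚ)
      ∏<-factor-0 zero = refl
      ∏<-factor-0 (suc M) with marked M
      ... | true  = trans (*-identityˡ _) (∏<-factor-0 M)
      ... | false = *-zeroˡ (∏< M (λ i → factor (marked i) 0))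

    factor-step : ∀ x m → p * factor true m + q * factor x m ≡ factor x (suc m)
    factor-step true  m = marked-step p
      where
      marked-step : ∀ p → p * 1ℚ + (1ℚ - p) * 1ℚ ≡ 1ℚ
      marked-step = solve-∀ ℚ-ring
    factor-step false m = unmarked-step p (q ^ℚ m)
      where
      unmarked-step : ∀ p x → p * 1ℚ + (1ℚ - p) * (1ℚ - x) ≡ 1ℚ - (1ℚ - p) * x
      unmarked-step = solve-∀ ℚ-ring

    reliabilitySum≡∏ : ∀ L marked →
      reliabilitySum marked L ≡ ∏< N (λ i → factor (marked i) (multiplicity i L))
    reliabilitySum≡∏ []      marked = reliabilitySum-[] marked
    reliabilitySum≡∏ (e ∷ L) marked = begin
      reliabilitySum marked (e ∷ L)
        ≡⟨ reliabilitySum-∷ marked e L ⟩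
      p * reliabilitySum (mark k marked) L + q * reliabilitySum marked L
        ≡⟨ cong₂ (λ x y → p * x + q * y)
                 (reliabilitySum≡∏ L (mark k marked)) (reliabilitySum≡∏ L marked) ⟩
      p * ∏< N (λ i → factor (mark k marked i) (m i)) + q * ∏< N (λ i → factor (marked i) (m i))
        ≡⟨ ∏<-affine p N k marked-elsewhere unmarked-elsewhere (at-k (marked k)) ⟩
      ∏< N (λ i → factor (marked i) (multiplicity i (e ∷ L))) ∎
      where
      open ≡-Reasoning
      k = index e
      m = λ i → multiplicity i L
      marked-elsewhere : ∀ i → i ≢ k →
        factor (mark k marked i) (m i) ≡ factor (marked i) (multiplicity i (e ∷ L))
      marked-elsewhere i i≢k rewrite dec-false (k ≟ i) (≢-sym i≢k) | ∨-identityʳ (marked i) = refl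
      unmarked-elsewhere : ∀ i → i ≢ k →
        factor (marked i) (m i) ≡ factor (marked i) (multiplicity i (e ∷ L))
      unmarked-elsewhere i i≢k rewrite dec-false (k ≟ i) (≢-sym i≢k) = refl
      at-k : ∀ x →
        p * factor (x ∨ does (k ≟ k)) (m k) + q * factor x (m k) ≡ factor x (multiplicity k (e ∷ L))
      at-k x rewrite dec-true (k ≟ k) refl | ∨-zeroʳ x = factor-step x (m k)

module SchreierLine where

  open Counting
  open import Data.Bool using (not; _xor_)
  import Data.Bool.Properties
  open import Data.Bool.Properties
    using (∧-conicalˡ; ∧-conicalʳ; ¬-not; not-injective; not-involutive; xor-assoc; xor-same; xor-identityʳ)
  open import Data.Nat using (_+_; _≤_; z≤n; _⊓_; _≟_; _≤?_; s≤s⁻¹)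
  open import Data.Nat.Properties
    using (≤-antisym; ≤-trans; ≤-<-trans; ≰⇒>; m^n>0; ≤-refl; <-trans; n<1+n; m≤n⇒m⊓n≡m; m≥n⇒m⊓n≡n;
           n≤1+n; <-irrefl; +-assoc; +-comm; +-identityʳ; 1+n≢n; +-cancelˡ-≡; +-suc; suc-injective)
  open import Data.Product using (proj₁; proj₂)
  open import Data.Sum using (_⊎_; inj₁; inj₂)
  open import Data.List using (filter)
  open import Data.List.Properties using (map-cong)
  open import Data.List.Membership.Propositional using (_∈_)
  open import Data.Nat.ListAction using (sum)
  open import Data.Vec using ([]; _∷_)
  open import Data.Vec.Properties using (≡-dec; ∷-injectiveʳ)
  open import Function using (case_of_)
  open import Relation.Binary.Definitions using (DecidableEquality)
  open import Relation.Binary.Construct.Closure.ReflexiveTransitive using (Star; ε; _◅_; _◅◅_; reverse)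
  open import Relation.Nullary.Decidable using (T?)

  even : ℕ → Bool
  even zero    = true
  even (suc k) = not (even k)

  double : ℕ → ℕ
  double zero    = zero
  double (suc k) = suc (suc (double k))

  bit : Bool → ℕ
  bit false = 0
  bit true  = 1

  xor-cancelʳ : ∀ x y → (x xor y) xor y ≡ x
  xor-cancelʳ x y = trans (xor-assoc x y y) (trans (cong (x xor_) (xor-same y)) (xor-identityʳ x))

  xor-injectiveʳ : ∀ {x y} z → x xor z ≡ y xor z → x ≡ y
  xor-injectiveʳ {x} {y} z eq =
    trans (sym (xor-cancelʳ x z)) (trans (cong (_xor z) eq) (xor-cancelʳ y z))

  even-double : ∀ k → even (double k) ≡ true
  even-double zero    = refl
  even-double (suc k) = trans (not-involutive _) (even-double k)

  even-bit+double : ∀ e k → even (bit e + double k) ≡ not e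
  even-bit+double false k = even-double k
  even-bit+double true  k = cong not (even-double k)

  double-injective : ∀ {j k} → double j ≡ double k → j ≡ k
  double-injective {zero}  {zero}  _  = refl
  double-injective {suc j} {suc k} eq = cong suc (double-injective (suc-injective (suc-injective eq)))

  bit+double-injective : ∀ e e′ {j k} → bit e + double j ≡ bit e′ + double k → e ≡ e′ × j ≡ k
  bit+double-injective e e′ {j} {k} eq
    with not-injective (trans (sym (even-bit+double e j)) (trans (cong even eq) (even-bit+double e′ k)))
  ... | refl = refl , double-injective (+-cancelˡ-≡ (bit e) _ _ eq)

  bit+double-split : ∀ k → Σ Bool λ e → Σ ℕ λ j → k ≡ bit e + double j
  bit+double-split zero = false , 0 , refl
  bit+double-split (suc k) with bit+double-split k
  ... | false , j , refl = true , j , refl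
  ... | true  , j , refl = false , suc j , refl

  bit+double-< : ∀ e {j m} → j < m → bit e + double j < double m
  bit+double-< false {zero}  {suc m} _         = s≤s z≤n
  bit+double-< true  {zero}  {suc m} _         = s≤s (s≤s z≤n)
  bit+double-< false {suc j} {suc m} (s≤s j<m) = s≤s (s≤s (bit+double-< false j<m))
  bit+double-< true  {suc j} {suc m} (s≤s j<m) = s≤s (s≤s (bit+double-< true j<m))

  bit+double-<⁻¹ : ∀ e {j m} → bit e + double j < double m → j < m
  bit+double-<⁻¹ e     {zero}  {suc m} _                 = s≤s z≤n
  bit+double-<⁻¹ false {suc j} {suc m} (s≤s (s≤s lt)) = s≤s (bit+double-<⁻¹ false lt)
  bit+double-<⁻¹ true  {suc j} {suc m} (s≤s (s≤s lt)) = s≤s (bit+double-<⁻¹ true lt)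

  2^suc : ∀ n → 2 ^ suc n ≡ double (2 ^ n)
  2^suc n = go (2 ^ n)
    where
    go : ∀ k → k + (k + 0) ≡ double k
    go zero    = refl
    go (suc k) = cong suc (trans (+-suc k (k + 0)) (cong suc (go k)))

  -- The index of w in the numbering v₁, …, v_{2ⁿ} along the line, shifted to start at 0:
  -- a Gray code in which the first letter is the least significant digit.
  position : ∀ {n} → Word n → ℕ
  position []      = 0
  position (x ∷ w) = bit (x xor even (position w)) + double (position w)

  position-injective : ∀ {n} (u v : Word n) → position u ≡ position v → u ≡ v
  position-injective []      []      _  = refl
  position-injective (x ∷ u) (y ∷ v) eq
    with bit+double-injective _ _ eq
  ... | heads , tails with position-injective u v tails
  ... | refl = cong (_∷ u) (xor-injectiveʳ (even (position u)) heads)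

  position-< : ∀ {n} (w : Word n) → position w < 2 ^ n
  position-< []              = s≤s z≤n
  position-< {suc n} (x ∷ w) =
    subst (position (x ∷ w) <_) (sym (2^suc n)) (bit+double-< (x xor even (position w)) (position-< w))

  position-surjective : ∀ n {k} → k < 2 ^ n → Σ (Word n) λ w → position w ≡ k
  position-surjective zero    {zero}  _ = [] , refl
  position-surjective zero    {suc k} (s≤s ())
  position-surjective (suc n) {k} k<2^n with bit+double-split k
  ... | e , j , refl
    with position-surjective n {j} (bit+double-<⁻¹ e (subst (bit e + double j <_) (2^suc n) k<2^n))
  ... | w , refl = (e xor even (position w)) ∷ w ,
                   cong (λ x → bit x + double (position w)) (xor-cancelʳ e (even (position w)))

  position-unique : ∀ {n m} {x y : Word n} → position x ≡ m → position y ≡ m → x ≡ y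
  position-unique {x = x} {y} p q = position-injective x y (trans p (sym q))

  Segment : ℕ → ℕ → ℕ → Set
  Segment k i j = (i ≡ k × j ≡ suc k) ⊎ (j ≡ k × i ≡ suc k)

  segment-sym : ∀ {k i j} → Segment k i j → Segment k j i
  segment-sym (inj₁ ends) = inj₂ ends
  segment-sym (inj₂ ends) = inj₁ ends

  segment-⊓ : ∀ {k i j} → Segment k i j → i ⊓ j ≡ k
  segment-⊓ {k} (inj₁ (refl , refl)) = m≤n⇒m⊓n≡m (n≤1+n k)
  segment-⊓ {k} (inj₂ (refl , refl)) = m≥n⇒m⊓n≡n (n≤1+n k)

  segment-distinct : ∀ {k i j} → Segment k i j → i ≢ j
  segment-distinct (inj₁ (refl , refl)) eq = 1+n≢n (sym eq)
  segment-distinct (inj₂ (refl , refl)) eq = 1+n≢n eq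

  segment-< : ∀ {k i j m} → Segment k i j → i < m → j < m → k < m
  segment-< (inj₁ (refl , _)) i<m _   = i<m
  segment-< (inj₂ (refl , _)) _   j<m = j<m

  segment-ends : ∀ {n k} {u₁ u₂ u v : Word n} →
    Segment k (position u₁) (position u₂) → Segment k (position u) (position v) →
    (u ≡ u₁ × v ≡ u₂) ⊎ (u ≡ u₂ × v ≡ u₁)
  segment-ends (inj₁ (p₁ , p₂)) (inj₁ (q₁ , q₂)) = inj₁ (position-unique q₁ p₁ , position-unique q₂ p₂)
  segment-ends (inj₁ (p₁ , p₂)) (inj₂ (q₁ , q₂)) = inj₂ (position-unique q₂ p₂ , position-unique q₁ p₁)
  segment-ends (inj₂ (p₁ , p₂)) (inj₁ (q₁ , q₂)) = inj₂ (position-unique q₁ p₁ , position-unique q₂ p₂)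
  segment-ends (inj₂ (p₁ , p₂)) (inj₂ (q₁ , q₂)) = inj₁ (position-unique q₂ p₂ , position-unique q₁ p₁)

  segment-crossing : ∀ {k i j m} → Segment k i j → i ≤ m → m < j → k ≡ m
  segment-crossing (inj₁ (refl , refl)) k≤m m<1+k = ≤-antisym k≤m (s≤s⁻¹ m<1+k)
  segment-crossing (inj₂ (refl , refl)) 1+k≤m m<k =
    ⊥-elim (<-irrefl refl (≤-trans 1+k≤m (≤-trans (n≤1+n _) m<k)))

  LoopOrSegment : (ℕ → ℕ) → ∀ {n} → Word n → Word n → Set
  LoopOrSegment f u v = v ≡ u ⊎ Σ ℕ λ m → Segment (f m) (position u) (position v)

  a-segment : ∀ {n} x (w : Word n) →
    Segment (double (position w)) (position (x ∷ w)) (position (act a (x ∷ w)))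
  a-segment false w with even (position w)
  ... | true  = inj₂ (refl , refl)
  ... | false = inj₁ (refl , refl)
  a-segment true  w with even (position w)
  ... | true  = inj₁ (refl , refl)
  ... | false = inj₂ (refl , refl)

  segment-false : ∀ {n} {w w′ : Word n} {k} → Segment (double k) (position w) (position w′) →
    Segment (suc (double (double k))) (position (false ∷ w)) (position (false ∷ w′))
  segment-false {k = k} (inj₁ (p , p′)) rewrite p | p′ | even-double k = inj₁ (refl , refl)
  segment-false {k = k} (inj₂ (p , p′)) rewrite p | p′ | even-double k = inj₂ (refl , refl)

  segment-true : ∀ {n} {w w′ : Word n} {k} → Segment (suc (double k)) (position w) (position w′) →
    Segment (suc (double (suc (double k)))) (position (true ∷ w)) (position (true ∷ w′))
  segment-true {k = k} (inj₁ (p , p′)) rewrite p | p′ | even-double k = inj₁ (refl , refl)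
  segment-true {k = k} (inj₂ (p , p′)) rewrite p | p′ | even-double k = inj₂ (refl , refl)

  lift-false : ∀ {n} {w w′ : Word n} → LoopOrSegment double w w′ →
    LoopOrSegment (λ m → suc (double m)) (false ∷ w) (false ∷ w′)
  lift-false (inj₁ refl) = inj₁ refl
  lift-false {w = w} {w′} (inj₂ (m , span)) = inj₂ (double m , segment-false {w = w} {w′} span)

  lift-true : ∀ {n} {w w′ : Word n} → LoopOrSegment (λ m → suc (double m)) w w′ →
    LoopOrSegment (λ m → suc (double m)) (true ∷ w) (true ∷ w′)
  lift-true (inj₁ refl) = inj₁ refl
  lift-true {w = w} {w′} (inj₂ (m , span)) = inj₂ (suc (double m) , segment-true {w = w} {w′} span)

  a-edge : ∀ {n} (u : Word n) → LoopOrSegment double u (act a u)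
  a-edge []      = inj₁ refl
  a-edge (x ∷ w) = inj₂ (position w , a-segment x w)

  b-edge : ∀ {n} (u : Word n) → LoopOrSegment (λ m → suc (double m)) u (act b u)
  c-edge : ∀ {n} (u : Word n) → LoopOrSegment (λ m → suc (double m)) u (act c u)
  d-edge : ∀ {n} (u : Word n) → LoopOrSegment (λ m → suc (double m)) u (act d u)
  b-edge []          = inj₁ refl
  b-edge (false ∷ w) = lift-false (a-edge w)
  b-edge (true  ∷ w) = lift-true (c-edge w)
  c-edge []          = inj₁ refl
  c-edge (false ∷ w) = lift-false (a-edge w)
  c-edge (true  ∷ w) = lift-true (d-edge w)
  d-edge []          = inj₁ refl
  d-edge (false ∷ w) = inj₁ refl
  d-edge (true  ∷ w) = lift-true (b-edge w)

  loop-or-segment : ∀ {f} {n} {u v : Word n} → LoopOrSegment f u v →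
    v ≡ u ⊎ Σ ℕ λ k → Segment k (position u) (position v)
  loop-or-segment (inj₁ loop)       = inj₁ loop
  loop-or-segment (inj₂ (m , span)) = inj₂ (_ , span)

  edge-geometry : ∀ s {n} (u : Word n) → act s u ≡ u ⊎ Σ ℕ λ k → Segment k (position u) (position (act s u))
  edge-geometry a u = loop-or-segment (a-edge u)
  edge-geometry b u = loop-or-segment (b-edge u)
  edge-geometry c u = loop-or-segment (c-edge u)
  edge-geometry d u = loop-or-segment (d-edge u)

  act-involutive : ∀ s {n} (u : Word n) → act s (act s u) ≡ u
  act-involutive _ []          = refl
  act-involutive a (false ∷ u) = refl
  act-involutive a (true  ∷ u) = refl
  act-involutive b (false ∷ u) = cong (false ∷_) (act-involutive a u)
  act-involutive b (true  ∷ u) = cong (true ∷_) (act-involutive c u)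
  act-involutive c (false ∷ u) = cong (false ∷_) (act-involutive a u)
  act-involutive c (true  ∷ u) = cong (true ∷_) (act-involutive d u)
  act-involutive d (false ∷ u) = refl
  act-involutive d (true  ∷ u) = cong (true ∷_) (act-involutive b u)

  _≟ʷ_ : ∀ {n} → DecidableEquality (Word n)
  _≟ʷ_ = ≡-dec Data.Bool.Properties._≟_

  joins : Gen → ∀ {n} → Word n → Word n → Bool
  joins s u v = does (act s u ≟ʷ v)

  joins-sym : ∀ s {n} (u v : Word n) → joins s u v ≡ joins s v u
  joins-sym s u v with act s u ≟ʷ v | act s v ≟ʷ u
  ... | yes _  | yes _  = refl
  ... | no _   | no _   = refl
  ... | yes su | no ¬sv = ⊥-elim (¬sv (trans (cong (act s) (sym su)) (act-involutive s u)))
  ... | no ¬su | yes sv = ⊥-elim (¬su (trans (cong (act s) (sym sv)) (act-involutive s v)))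

  xor-solve : ∀ x y {z} → x xor y ≡ z → x ≡ z xor y
  xor-solve x y refl = sym (xor-cancelʳ x y)

  consecutive-∷ : ∀ {n} x y (v v′ : Word n) → position (y ∷ v′) ≡ suc (position (x ∷ v)) →
      (v′ ≡ v × y ≡ not x × x xor even (position v) ≡ false)
    ⊎ (y ≡ x × position v′ ≡ suc (position v) × x xor even (position v) ≡ true)
  consecutive-∷ x y v v′ eq with x xor even (position v) in hx
  ... | false with bit+double-injective (y xor even (position v′)) true eq
  ...   | hy , tails with position-injective v′ v tails
  ...     | refl = inj₁ (refl , trans (xor-solve y _ hy) (cong not (sym (xor-solve x _ hx))) , refl)
  consecutive-∷ x y v v′ eq | true with bit+double-injective (y xor even (position v′)) false eq
  ...   | hy , tails =
    inj₂ (trans (xor-solve y _ hy) (trans (cong even tails) (sym (xor-solve x _ hx))) , tails , refl)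

  -- Consecutive words differ only in the first letter (then a, and none of b, c, d, joins them) or
  -- share it and have consecutive tails; then b, c, d act on the tails as a, a, id or as c, d, b, so
  -- by induction exactly two of them join the words.
  bcdJoins : ∀ {n} → Word n → Word n → ℕ
  bcdJoins w w′ = bit (joins b w w′) + bit (joins c w w′) + bit (joins d w w′)

  JoinProfile : ∀ {n} → Word n → Word n → Set
  JoinProfile w w′ = joins a w w′ ≡ even (position w) × bcdJoins w w′ ≡ (if even (position w) then 0 else 2)

  private
    heads-differ : ∀ {n} x (v : Word n) →
      joins a (x ∷ v) (not x ∷ v) ≡ true × bcdJoins (x ∷ v) (not x ∷ v) ≡ 0
    heads-differ false v = dec-true (v ≟ʷ v) refl , refl
    heads-differ true  v = dec-true (v ≟ʷ v) refl , refl

    heads-agree : ∀ {n} x (v v′ : Word n) → x xor even (position v) ≡ true → v ≢ v′ → JoinProfile v v′ →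
      joins a (x ∷ v) (x ∷ v′) ≡ false × bcdJoins (x ∷ v) (x ∷ v′) ≡ 2
    heads-agree false v v′ v-even v≢v′ (a-joins , _)
      rewrite trans a-joins v-even | dec-false (v ≟ʷ v′) v≢v′ = refl , refl
    heads-agree true  v v′ v-odd  _    (_ , bcd) =
      refl , trans (+-comm (bit C + bit D) (bit B))
                   (trans (sym (+-assoc (bit B) (bit C) (bit D)))
                          (trans bcd (cong (if_then 0 else 2) (not-injective v-odd))))
      where
      B = joins b v v′
      C = joins c v v′
      D = joins d v v′

  consecutive-joins : ∀ {n} (w w′ : Word n) → position w′ ≡ suc (position w) → JoinProfile w w′
  consecutive-joins (x ∷ v) (y ∷ v′) eq
    rewrite even-bit+double (x xor even (position v)) (position v)
    with consecutive-∷ x y v v′ eq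
  ... | inj₁ (refl , refl , hx) rewrite hx = heads-differ x v
  ... | inj₂ (refl , tails , hx) rewrite hx =
    heads-agree x v v′ hx (λ v≡v′ → 1+n≢n (trans (sym tails) (cong position (sym v≡v′))))
      (consecutive-joins v v′ tails)

  segmentMultiplicity : ℕ → ℕ
  segmentMultiplicity k = if even k then 1 else 2

  segmentMultiplicity-even : ∀ k → segmentMultiplicity (double k) ≡ 1
  segmentMultiplicity-even k rewrite even-double k = refl

  segmentMultiplicity-odd : ∀ k → segmentMultiplicity (suc (double k)) ≡ 2
  segmentMultiplicity-odd k rewrite even-double k = refl

  joinCount : ∀ {n} → Word n → Word n → ℕ
  joinCount w w′ = sum (map (λ s → bit (joins s w w′)) gens)

  consecutive-joinCount : ∀ {n} (w w′ : Word n) → position w′ ≡ suc (position w) →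
    joinCount w w′ ≡ segmentMultiplicity (position w)
  consecutive-joinCount w w′ eq with consecutive-joins w w′ eq
  ... | a-joins , bcd
    rewrite +-identityʳ (bit (joins d w w′))
          | sym (+-assoc (bit (joins b w w′)) (bit (joins c w w′)) (bit (joins d w w′)))
          | bcd | a-joins
    with even (position w)
  ... | true  = refl
  ... | false = refl

  -- Loops get index 2ⁿ, beyond every segment.
  index : ∀ {n} → Edge n → ℕ
  index {n} (s , u) = if does (act s u ≟ʷ u) then 2 ^ n else position u ⊓ position (act s u)

  index-segment : ∀ {n} s (u : Word n) {k} → Segment k (position u) (position (act s u)) → index (s , u) ≡ k
  index-segment s u span with act s u ≟ʷ u
  ... | yes loop = ⊥-elim (segment-distinct span (cong position (sym loop)))
  ... | no _     = segment-⊓ span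

  index-loop : ∀ {n} s {u : Word n} → act s u ≡ u → index (s , u) ≡ 2 ^ n
  index-loop s {u} loop rewrite dec-true (act s u ≟ʷ u) loop = refl

  segment-index : ∀ {n} s (u : Word n) {k} → index (s , u) ≡ k → k < 2 ^ n →
    Segment k (position u) (position (act s u))
  segment-index s u refl index< with edge-geometry s u
  ... | inj₂ (_ , span) =
    subst (λ k → Segment k (position u) (position (act s u))) (sym (index-segment s u span)) span
  ... | inj₁ loop       = ⊥-elim (<-irrefl (index-loop s loop) index<)

  crossing-index : ∀ {n} (e : Edge n) {x z : Word n} {i} →
    Joins e x z → position x ≤ i → i < position z → index e ≡ i
  crossing-index (s , u) {i = i} ends x≤i i<z with edge-geometry s u | ends
  ... | inj₁ loop | inj₁ (refl , refl) = ⊥-elim (<-irrefl (cong position (sym loop)) (≤-<-trans x≤i i<z))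
  ... | inj₁ loop | inj₂ (refl , refl) = ⊥-elim (<-irrefl (cong position loop) (≤-<-trans x≤i i<z))
  ... | inj₂ (k , span) | inj₁ (refl , refl) = trans (index-segment s u span) (segment-crossing span x≤i i<z)
  ... | inj₂ (k , span) | inj₂ (refl , refl) =
    trans (index-segment s u span) (segment-crossing (segment-sym span) x≤i i<z)

  lexLeq-total : ∀ {n} (u v : Word n) → lexLeq u v ≡ false → lexLeq v u ≡ true
  lexLeq-total []          []          ()
  lexLeq-total (false ∷ u) (false ∷ v) h = lexLeq-total u v h
  lexLeq-total (true  ∷ u) (true  ∷ v) h = lexLeq-total u v h
  lexLeq-total (true  ∷ u) (false ∷ v) _ = refl

  lexLeq-antisym : ∀ {n} {u v : Word n} → lexLeq u v ≡ true → lexLeq v u ≡ true → u ≡ v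
  lexLeq-antisym {u = []}        {[]}        _  _  = refl
  lexLeq-antisym {u = false ∷ u} {false ∷ v} h₁ h₂ = cong (false ∷_) (lexLeq-antisym h₁ h₂)
  lexLeq-antisym {u = true  ∷ u} {true  ∷ v} h₁ h₂ = cong (true ∷_) (lexLeq-antisym h₁ h₂)

  countᵇ-allWords : ∀ n (g : Word n → Bool) w → (∀ u → g u ≡ true → u ≡ w) →
    countᵇ g (allWords n) ≡ bit (g w)
  countᵇ-allWords zero g [] _ with g []
  ... | true  = refl
  ... | false = refl
  countᵇ-allWords (suc n) g (x ∷ w) support
    rewrite countᵇ-++ g (map (false ∷_) (allWords n)) (map (true ∷_) (allWords n))
          | countᵇ-map g (false ∷_) (allWords n) | countᵇ-map g (true ∷_) (allWords n)
    with x
  ... | false = trans (cong₂ _+_ (countᵇ-allWords n _ w (λ u g≡ → ∷-injectiveʳ (support _ g≡)))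
                                (countᵇ-none _ (allWords n) (λ u → ¬-not (λ g≡ → case support _ g≡ of λ ()))))
                      (+-identityʳ _)
  ... | true  = cong₂ _+_ (countᵇ-none _ (allWords n) (λ u → ¬-not (λ g≡ → case support _ g≡ of λ ())))
                          (countᵇ-allWords n _ w (λ u g≡ → ∷-injectiveʳ (support _ g≡)))

  labelledEdges : Gen → ∀ n → List (Edge n)
  labelledEdges s n = map (s ,_) (filter (λ u → T? (lexLeq u (act s u))) (allWords n))

  labelled-count-ordered : ∀ {n} s {i} {u₁ u₂ : Word n} → Segment i (position u₁) (position u₂) →
    lexLeq u₁ u₂ ≡ true →
    countᵇ (λ e → does (index e ≟ i)) (labelledEdges s n) ≡ bit (joins s u₁ u₂)
  labelled-count-ordered {n} s {i} {u₁} {u₂} span u₁≤u₂ = begin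
    countᵇ (λ e → does (index e ≟ i)) (labelledEdges s n)
      ≡⟨ countᵇ-map (λ e → does (index e ≟ i)) (s ,_)
                    (filter (λ u → T? (lexLeq u (act s u))) (allWords n)) ⟩
    countᵇ (λ u → does (index (s , u) ≟ i)) (filter (λ u → T? (lexLeq u (act s u))) (allWords n))
      ≡⟨ countᵇ-filter (λ u → does (index (s , u) ≟ i)) (λ u → lexLeq u (act s u)) (allWords n) ⟩
    countᵇ selected (allWords n)
      ≡⟨ countᵇ-allWords n selected u₁ (λ u sel → proj₁ (selected-ends u sel)) ⟩
    bit (selected u₁)
      ≡⟨ cong bit selected-u₁ ⟩
    bit (joins s u₁ u₂) ∎
    where
    open ≡-Reasoning
    selected : Word n → Bool
    selected u = lexLeq u (act s u) ∧ does (index (s , u) ≟ i)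

    selected-ends : ∀ u → selected u ≡ true → u ≡ u₁ × act s u ≡ u₂
    selected-ends u sel
      with segment-ends span
             (segment-index s u (witness (index (s , u) ≟ i) (∧-conicalʳ (lexLeq u (act s u)) _ sel))
                                (segment-< span (position-< u₁) (position-< u₂)))
    ... | inj₁ ends            = ends
    ... | inj₂ (refl , su≡u₁) =
      ⊥-elim (segment-distinct span (cong position (lexLeq-antisym {u = u₁} {u₂} u₁≤u₂ u₂≤u₁)))
      where
      u₂≤u₁ : lexLeq u₂ u₁ ≡ true
      u₂≤u₁ = subst (λ v → lexLeq u₂ v ≡ true) su≡u₁ (∧-conicalˡ (lexLeq u₂ (act s u₂)) _ sel)

    selected-u₁ : selected u₁ ≡ joins s u₁ u₂
    selected-u₁ with act s u₁ ≟ʷ u₂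
    ... | no ¬joined = ¬-not (λ sel → ¬joined (proj₂ (selected-ends u₁ sel)))
    ... | yes joined = cong₂ _∧_ (trans (cong (lexLeq u₁) joined) u₁≤u₂)
        (dec-true (index (s , u₁) ≟ i)
          (index-segment s u₁ (subst (λ v → Segment i (position u₁) (position v)) (sym joined) span)))

  labelled-count : ∀ {n} s {i} {u₁ u₂ : Word n} → Segment i (position u₁) (position u₂) →
    countᵇ (λ e → does (index e ≟ i)) (labelledEdges s n) ≡ bit (joins s u₁ u₂)
  labelled-count {n} s {u₁ = u₁} {u₂} span with lexLeq u₁ u₂ in order
  ... | true  = labelled-count-ordered {n} s {u₁ = u₁} {u₂} span order
  ... | false = trans (labelled-count-ordered {n} s {u₁ = u₂} {u₁} (segment-sym span) (lexLeq-total u₁ u₂ order))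
                      (cong bit (joins-sym s u₂ u₁))

  index-multiplicity : ∀ {n i} → suc i < 2 ^ n →
    countᵇ (λ e → does (index e ≟ i)) (edges n) ≡ segmentMultiplicity i
  index-multiplicity {n} {i} lt with position-surjective n {i} (<-trans (n<1+n i) lt) | position-surjective n lt
  ... | wᵢ , refl | wⱼ , wⱼ-next = begin
    countᵇ (λ e → does (index e ≟ i)) (edges n)
      ≡⟨ countᵇ-concatMap _ (λ s → labelledEdges s n) gens ⟩
    sum (map (λ s → countᵇ (λ e → does (index e ≟ i)) (labelledEdges s n)) gens)
      ≡⟨ cong sum (map-cong (λ s → labelled-count s {u₁ = wᵢ} {wⱼ} (inj₁ (refl , wⱼ-next))) gens) ⟩
    joinCount wᵢ wⱼ
      ≡⟨ consecutive-joinCount wᵢ wⱼ wⱼ-next ⟩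
    segmentMultiplicity i ∎
    where open ≡-Reasoning

  Crossed : ∀ {n} → List (Edge n) → Set
  Crossed {n} S = ∀ i → suc i < 2 ^ n → Σ (Edge n) λ e → e ∈ S × index e ≡ i

  module _ {n : ℕ} {S : List (Edge n)} where

    crossing : ∀ {x y : Word n} i → Star (Adj S) x y → position x ≤ i → i < position y →
      Σ (Edge n) λ e → e ∈ S × index e ≡ i
    crossing i ε x≤i i<x = ⊥-elim (<-irrefl refl (≤-<-trans x≤i i<x))
    crossing i (_◅_ {j = z} (e , e∈S , ends) path) x≤i i<y with position z ≤? i
    ... | yes z≤i = crossing i path z≤i i<y
    ... | no  z≰i = e , e∈S , crossing-index e ends x≤i (≰⇒> z≰i)

    origin : Word n
    origin = proj₁ (position-surjective n (m^n>0 2 n))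

    connected⇒crossed : Connected S → Crossed S
    connected⇒crossed connected i 1+i<2^n =
      let y , y-at = position-surjective n 1+i<2^n
          _ , origin-at = position-surjective n {0} (m^n>0 2 n)
      in crossing i (connected origin y) (subst (_≤ i) (sym origin-at) z≤n) (subst (i <_) (sym y-at) ≤-refl)

    adj-sym : ∀ {x y : Word n} → Adj S x y → Adj S y x
    adj-sym (e , e∈S , inj₁ ends) = e , e∈S , inj₂ ends
    adj-sym (e , e∈S , inj₂ ends) = e , e∈S , inj₁ ends

    reach : Crossed S → ∀ k (w : Word n) → position w ≡ k → Star (Adj S) origin w
    reach crossed zero w w-at =
      subst (Star (Adj S) origin) (position-unique (proj₂ (position-surjective n (m^n>0 2 n))) w-at) ε
    reach crossed (suc k) w w-at with crossed k (subst (_< 2 ^ n) w-at (position-< w))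
    ... | (s , u) , e∈S , idx with segment-index s u idx (<-trans (n<1+n k) (subst (_< 2 ^ n) w-at (position-< w)))
    ... | inj₁ (u-at , su-at) =
      subst (Star (Adj S) origin) (position-unique su-at w-at)
        (reach crossed k u u-at ◅◅ ((s , u) , e∈S , inj₁ (refl , refl)) ◅ ε)
    ... | inj₂ (su-at , u-at) =
      subst (Star (Adj S) origin) (position-unique u-at w-at)
        (reach crossed k (act s u) su-at ◅◅ ((s , u) , e∈S , inj₂ (refl , refl)) ◅ ε)

    crossed⇒connected : Crossed S → Connected S
    crossed⇒connected crossed x y =
      reverse adj-sym (reach crossed _ x refl) ◅◅ reach crossed _ y refl

open Counting
open RationalSums
open SchreierLine
open import Data.Nat.Properties using (m^n>0)
open import Data.Rational using (ℚ; 0ℚ; 1ℚ; _≤_; _*_; _-_; _+_)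
open import Data.List.Properties using (map-cong)
open import Function using (case_of_)
open import Tactic.RingSolver using (solve-∀)

suc<⇒<∸1 : ∀ {i m} → suc i < m → i < m ∸ 1
suc<⇒<∸1 {m = suc m} (s≤s i<m) = i<m

<∸1⇒suc< : ∀ {i m} → i < m ∸ 1 → suc i < m
<∸1⇒suc< {m = zero}  ()
<∸1⇒suc< {m = suc m} i<m = s≤s i<m

module _ {n : ℕ} where

  open SegmentReliability (index {n}) (2 ^ n ∸ 1)

  does-connected : (dec : (S : List (Edge n)) → Dec (Connected S)) → ∀ S →
    does (dec S) ≡ covers (λ _ → false) S
  does-connected dec S with covers (λ _ → false) S in covered
  ... | true  = dec-true (dec S) (crossed⇒connected λ i 1+i<2ⁿ →
      hits-elim S (allBelow-elim (2 ^ n ∸ 1) covered i (suc<⇒<∸1 1+i<2ⁿ)))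
  ... | false = dec-false (dec S) λ connected →
      case trans (sym covered) (allBelow-intro (2 ^ n ∸ 1) λ i i<N →
             let _ , e∈S , idx = connected⇒crossed connected i (<∸1⇒suc< i<N) in hits-intro e∈S idx)
      of λ ()

  reliability≡∏ : ∀ dec p →
    reliability n dec p ≡ ∏< (2 ^ n ∸ 1) (λ i → 1ℚ - (1ℚ - p) ^ℚ segmentMultiplicity i)
  reliability≡∏ dec p = begin
    reliability n dec p
      ≡⟨ cong sumℚ (map-cong (λ S → cong (λ t → if t then weight p (edges n) S else 0ℚ) (does-connected dec S))
                              (subsets (edges n))) ⟩
    reliabilitySum p (λ _ → false) (edges n)
      ≡⟨ reliabilitySum≡∏ p (edges n) (λ _ → false) ⟩
    ∏< (2 ^ n ∸ 1) (λ i → factor p false (multiplicity i (edges n)))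
      ≡⟨ ∏<-cong (2 ^ n ∸ 1) (λ i i<N → cong (factor p false) (index-multiplicity {n} (<∸1⇒suc< i<N))) ⟩
    ∏< (2 ^ n ∸ 1) (λ i → 1ℚ - (1ℚ - p) ^ℚ segmentMultiplicity i) ∎
    where open ≡-Reasoning

∏<-alternating : ∀ p {N} K → N ≡ suc (double K) →
  ∏< N (λ i → 1ℚ - (1ℚ - p) ^ℚ segmentMultiplicity i) ≡ (p ^ℚ N) * (((1ℚ + 1ℚ) - p) ^ℚ K)
∏<-alternating p zero refl = one-segment p
  where
  one-segment : ∀ p → (1ℚ - (1ℚ - p) * 1ℚ) * 1ℚ ≡ (p * 1ℚ) * 1ℚ
  one-segment = solve-∀ ℚ-ring
∏<-alternating p (suc K) refl = begin
  f (double (suc K)) * (f (suc (double K)) * ∏< (suc (double K)) f)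
    ≡⟨ cong₂ (λ m₁ m₂ → (1ℚ - q ^ℚ m₁) * ((1ℚ - q ^ℚ m₂) * ∏< (suc (double K)) f))
             (segmentMultiplicity-even (suc K)) (segmentMultiplicity-odd K) ⟩
  (1ℚ - q ^ℚ 1) * ((1ℚ - q ^ℚ 2) * ∏< (suc (double K)) f)
    ≡⟨ cong (λ x → (1ℚ - q ^ℚ 1) * ((1ℚ - q ^ℚ 2) * x)) (∏<-alternating p K refl) ⟩
  (1ℚ - q ^ℚ 1) * ((1ℚ - q ^ℚ 2) * ((p ^ℚ suc (double K)) * (((1ℚ + 1ℚ) - p) ^ℚ K)))
    ≡⟨ next-pair p (p ^ℚ suc (double K)) (((1ℚ + 1ℚ) - p) ^ℚ K) ⟩
  (p ^ℚ suc (double (suc K))) * (((1ℚ + 1ℚ) - p) ^ℚ suc K) ∎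
  where
  open ≡-Reasoning
  q = 1ℚ - p
  f = λ i → 1ℚ - q ^ℚ segmentMultiplicity i
  next-pair : ∀ p x y →
    (1ℚ - (1ℚ - p) * 1ℚ) * ((1ℚ - (1ℚ - p) * ((1ℚ - p) * 1ℚ)) * (x * y))
      ≡ (p * (p * x)) * (((1ℚ + 1ℚ) - p) * y)
  next-pair = solve-∀ ℚ-ring

2^suc∸1 : ∀ m → 2 ^ suc m ∸ 1 ≡ suc (double (2 ^ m ∸ 1))
2^suc∸1 m = trans (cong (_∸ 1) (2^suc m)) (double∸1 (m^n>0 2 m))
  where
  double∸1 : ∀ {x} → 0 < x → double x ∸ 1 ≡ suc (double (x ∸ 1))
  double∸1 {suc x} _ = refl

mainTheorem2 : (n : ℕ) → 1 ≤ℕ n →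
    (dec : (S : List (Edge n)) → Dec (Connected S)) →
    (p : ℚ) → 0ℚ ≤ p → p ≤ 1ℚ →
    reliability n dec p ≡ (p ^ℚ (2 ^ n ∸ 1)) * (((1ℚ + 1ℚ) - p) ^ℚ (2 ^ (n ∸ 1) ∸ 1))
mainTheorem2 (suc m) _ dec p _ _ =
  trans (reliability≡∏ dec p) (∏<-alternating p (2 ^ m ∸ 1) (2^suc∸1 m))
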